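{- Let $f:\mathbb{F}_2^n\to\mathbb{F}_2^n$ be a conjunctive Boolean network whose dependency graph $\mathfrak{D}(f)$ is strongly connected with loop number $c$, and let $k$ be a positive divisor of $c$. Then the set $D(k)=\{\mathbf{u}\in\mathbb{F}_2^n : f^k(\mathbf{u})=\mathbf{u}\}$ (the periodic points whose period divides $k$) has exactly $2^k$ elements.
   Context: $\mathbb{F}_2=\{0,1\}$. A conjunctive Boolean network is a map $f=(f_1,\dots,f_n):\mathbb{F}_2^n\to\mathbb{F}_2^n$ where each $f_i$ is a product (AND) of a nonempty set of variables. Its dependency graph $\mathfrak{D}(f)$ has vertices $1,\dots,n$ and an edge $i\to j$ iff $x_i$ appears in $f_j$. The loop number of a strongly connected graph (with at least one edge) is the gcd of the lengths of its simple directed cycles. -}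

module Defs where

open import Data.Nat using (ℕ; zero; suc)
open import Data.Nat.Divisibility using (_∣_)
open import Data.Bool using (Bool; true; false; not; _∨_)
open import Data.Fin using (Fin)
open import Data.Vec using (Vec; tabulate; lookup)
open import Data.List using (List; []; _∷_; map; allFin; length)
open import Data.Bool.ListAction using (and)
open import Data.List.Relation.Unary.Unique.Propositional using (Unique)
open import Data.Product using (∃; _×_)
open import Relation.Binary.PropositionalEquality using (_≡_)
open import Relation.Binary.Construct.Closure.ReflexiveTransitive using (Star)

-- A conjunctive Boolean network on n variables is determined by its
-- dependency data: Dep i j = true iff x_i appears in f_j.
-- Each f_j must be a product of a NONEMPTY set of variables.
Matrix : ℕ → Set
Matrix n = Fin n → Fin n → Bool

NonemptyInputs : ∀ {n} → Matrix n → Set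
NonemptyInputs {n} A = (j : Fin n) → ∃ λ (i : Fin n) → A i j ≡ true

network : ∀ {n} → Matrix n → Vec Bool n → Vec Bool n
network {n} A u = tabulate λ j → and (map (λ i → not (A i j) ∨ lookup u i) (allFin n))

iter : ∀ {a} {X : Set a} → ℕ → (X → X) → X → X
iter zero    g x = x
iter (suc k) g x = g (iter k g x)

Edge : ∀ {n} → Matrix n → Fin n → Fin n → Set
Edge A i j = A i j ≡ true

StronglyConnected : ∀ {n} → Matrix n → Set
StronglyConnected {n} A = (i j : Fin n) → Star (Edge A) i j

HasEdge : ∀ {n} → Matrix n → Set
HasEdge {n} A = ∃ λ (i : Fin n) → ∃ λ (j : Fin n) → Edge A i j

PathFrom : ∀ {n} → Matrix n → Fin n → List (Fin n) → Fin n → Set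
PathFrom A v []       w = Edge A v w
PathFrom A v (x ∷ xs) w = Edge A v x × PathFrom A x xs w

-- a simple directed cycle v → x₁ → ... → x_m → v with v, x₁, …, x_m
-- pairwise distinct; its length is m + 1 (the number of edges)
SimpleCycleLength : ∀ {n} → Matrix n → ℕ → Set
SimpleCycleLength {n} A L =
  ∃ λ (v : Fin n) → ∃ λ (xs : List (Fin n)) →
    Unique (v ∷ xs) × PathFrom A v xs v × L ≡ length (v ∷ xs)

IsLoopNumber : ∀ {n} → Matrix n → ℕ → Set
IsLoopNumber A c =
  (∀ L → SimpleCycleLength A L → c ∣ L) ×
  (∀ d → (∀ L → SimpleCycleLength A L → d ∣ L) → d ∣ c)

-- A closed walk in the dependency graph splits into simple cycles, so its length is a
-- multiple of k. Fixing a root r, all walks from r to a vertex j therefore have the same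
-- length modulo k, the level of j, and a walk from a to b has length level b - level a
-- modulo k. Coordinate j of f^m(u) is 1 iff u is 1 at the start of every walk of length m
-- ending at j. Walks of length k join vertices of equal level, and vertices of equal level
-- are joined by walks of length divisible by k, so the solutions of f^k(u) = u are exactly
-- the vectors constant on each of the k levels, all of which are nonempty.
module Submission where

open import Defs
open import Algebra.Properties.CommutativeSemigroup using (x∙yz≈y∙xz)
open import Axiom.UniquenessOfIdentityProofs using (module Decidable⇒UIP)
open import Data.Bool using (Bool; true; false; not; _∨_)
open import Data.Bool.ListAction using (all)
open import Data.Bool.Properties using (T-≡) renaming (_≟_ to _≟ᵇ_)
open import Data.Fin using (Fin; zero; suc; toℕ) renaming (_≟_ to _≟ᶠ_)
open import Data.Fin.Properties using (toℕ-injective; toℕ-fromℕ<; toℕ<n; 2↔Bool; *↔×)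
open import Data.List using (List; []; _∷_; _++_; [_]; length; allFin)
open import Data.List.Membership.Propositional.Properties using (∈-∃++; ∈-allFin)
open import Data.List.Properties using (length-++)
import Data.List.Relation.Unary.All as All
open import Data.List.Relation.Unary.All.Properties using (all⁺; all⁻; ¬Any⇒All¬)
open import Data.List.Relation.Unary.AllPairs using (_∷_)
open import Data.List.Relation.Unary.Unique.Propositional using (Unique; [])
open import Data.Nat using (ℕ; zero; suc; _+_; _*_; _∸_; _^_; _<_; _>_; z<s; NonZero)
open import Data.Nat.Divisibility using (_∣_; divides; ∣-trans; ∣m∣n⇒∣m+n; _∣0)
open import Data.Nat.DivMod
  using (_%_; _/_; _mod_; m≡m%n+[m/n]*n; [m+n]%n≡m%n; %-remove-+ʳ; m%n<n; m<n⇒m%n≡m)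
open import Data.Nat.Induction using (<-rec)
open import Data.Nat.Properties
  using ( +-comm; +-commutativeSemigroup; m+n∸m≡n; [m+n]∸[m+o]≡n∸o; *-distribʳ-∸
        ; m<m+n; m<n+m)
open import Data.Nat.Tactic.RingSolver using (solve-∀)
open import Data.Product using (Σ; ∃; ∃-syntax; _×_; _,_; proj₁; proj₂)
open import Data.Product.Function.NonDependent.Propositional using (_×-↔_)
open import Data.Sum using (_⊎_; inj₁; inj₂)
open import Data.Vec using (Vec; tabulate; lookup)
open import Data.Vec.Properties using (lookup∘tabulate; tabulate∘lookup; tabulate-cong; ≡-dec)
open import Function using (_∘_)
open import Function.Bundles using (_↔_; mk↔ₛ′; Equivalence)
open import Function.Properties.Inverse using (↔-sym; ↔-trans)
open import Relation.Binary.Construct.Closure.ReflexiveTransitive using (Star; ε; _◅_)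
open import Relation.Binary.Definitions using (DecidableEquality)
open import Relation.Binary.PropositionalEquality
  using (_≡_; refl; sym; trans; cong; cong₂; subst; module ≡-Reasoning)
open import Relation.Nullary using (yes; no)

open ≡-Reasoning

iter-suc : ∀ {a} {X : Set a} m (g : X → X) x → iter (suc m) g x ≡ iter m g (g x)
iter-suc zero    g x = refl
iter-suc (suc m) g x = cong g (iter-suc m g x)

iter-+ : ∀ {a} {X : Set a} m p (g : X → X) x → iter (m + p) g x ≡ iter m g (iter p g x)
iter-+ zero    p g x = refl
iter-+ (suc m) p g x = cong g (iter-+ m p g x)

iter-*-periodic : ∀ {a} {X : Set a} {k} {g : X → X} {x} →
                  iter k g x ≡ x → ∀ e → iter (e * k) g x ≡ x
iter-*-periodic         periodic zero    = refl
iter-*-periodic {k = k} {g} {x} periodic (suc e) = begin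
  iter (k + e * k) g x    ≡⟨ iter-+ k (e * k) g x ⟩
  iter k g (iter (e * k) g x) ≡⟨ cong (iter k g) (iter-*-periodic periodic e) ⟩
  iter k g x              ≡⟨ periodic ⟩
  x                       ∎

lookup-ext : ∀ {a} {X : Set a} {m} {xs ys : Vec X m} →
             (∀ i → lookup xs i ≡ lookup ys i) → xs ≡ ys
lookup-ext {xs = xs} {ys} h = begin
  xs                  ≡⟨ tabulate∘lookup xs ⟨
  tabulate (lookup xs) ≡⟨ tabulate-cong h ⟩
  tabulate (lookup ys) ≡⟨ tabulate∘lookup ys ⟩
  ys                  ∎

≡-from-true⇔true : ∀ {x y : Bool} →
                   (x ≡ true → y ≡ true) → (y ≡ true → x ≡ true) → x ≡ y
≡-from-true⇔true {false} {false} _ _ = refl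
≡-from-true⇔true {false} {true}  _ y⇒x = y⇒x refl
≡-from-true⇔true {true}  {false} x⇒y _ = sym (x⇒y refl)
≡-from-true⇔true {true}  {true}  _ _ = refl

not∨-true⁻ : ∀ {a b} → not a ∨ b ≡ true → a ≡ true → b ≡ true
not∨-true⁻ h refl = h

not∨-true⁺ : ∀ {a b} → (a ≡ true → b ≡ true) → not a ∨ b ≡ true
not∨-true⁺ {false} _ = refl
not∨-true⁺ {true}  h = h refl

Vec-Bool↔Fin-2^ : ∀ k → Vec Bool k ↔ Fin (2 ^ k)
Vec-Bool↔Fin-2^ zero =
  mk↔ₛ′ (λ _ → zero) (λ _ → Vec.[])
        (λ { zero → refl ; (suc ()) }) (λ { Vec.[] → refl })
Vec-Bool↔Fin-2^ (suc k) =
  ↔-trans uncons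
    (↔-trans (↔-sym 2↔Bool ×-↔ Vec-Bool↔Fin-2^ k) (↔-sym (*↔× {2} {2 ^ k})))
  where
  uncons : Vec Bool (suc k) ↔ (Bool × Vec Bool k)
  uncons = mk↔ₛ′ (λ { (b Vec.∷ v) → b , v }) (λ (b , v) → b Vec.∷ v)
                 (λ _ → refl) (λ { (_ Vec.∷ _) → refl })

module _ (k : ℕ) .{{_ : NonZero k}} where

  %-≡-from-∣+ : ∀ {m n t} → k ∣ m + t → k ∣ n + t → m % k ≡ n % k
  %-≡-from-∣+ {m} {n} {t} k∣m+t k∣n+t = begin
    m % k             ≡⟨ %-remove-+ʳ m k∣n+t ⟨
    (m + (n + t)) % k ≡⟨ cong (_% k) (x∙yz≈y∙xz +-commutativeSemigroup m n t) ⟩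
    (n + (m + t)) % k ≡⟨ %-remove-+ʳ n k∣m+t ⟩
    n % k             ∎

  ∣-from-%-+ : ∀ m {t} → (m + t) % k ≡ m % k → k ∣ t
  ∣-from-%-+ m {t} eq = divides (q₁ ∸ q₂) (begin
    t
      ≡⟨ m+n∸m≡n m t ⟨
    (m + t) ∸ m
      ≡⟨ cong₂ _∸_ (m≡m%n+[m/n]*n (m + t) k) (m≡m%n+[m/n]*n m k) ⟩
    ((m + t) % k + q₁ * k) ∸ (m % k + q₂ * k)
      ≡⟨ cong (λ r → r + q₁ * k ∸ (m % k + q₂ * k)) eq ⟩
    (m % k + q₁ * k) ∸ (m % k + q₂ * k)
      ≡⟨ [m+n]∸[m+o]≡n∸o (m % k) (q₁ * k) (q₂ * k) ⟩
    q₁ * k ∸ q₂ * k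
      ≡⟨ *-distribʳ-∸ k q₁ q₂ ⟨
    (q₁ ∸ q₂) * k
      ∎)
    where
    q₁ q₂ : ℕ
    q₁ = (m + t) / k
    q₂ = m / k

module _ {a} {X : Set a} where

  HasRepeat : List X → Set a
  HasRepeat ys = ∃[ as ] ∃[ x ] ∃[ bs ] ∃[ cs ] ys ≡ as ++ x ∷ bs ++ x ∷ cs

  length-repeat : ∀ (as : List X) x bs cs →
    length (as ++ x ∷ bs ++ x ∷ cs) ≡ length (bs ++ [ x ]) + length (as ++ x ∷ cs)
  length-repeat as x bs cs = begin
    length (as ++ x ∷ bs ++ x ∷ cs)                 ≡⟨ length-++ as ⟩
    length as + suc (length (bs ++ x ∷ cs))         ≡⟨ cong (λ l → length as + suc l)
                                                            (length-++ bs) ⟩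
    length as + suc (length bs + suc (length cs))   ≡⟨ shuffle (length as) (length bs)
                                                               (length cs) ⟩
    (length bs + 1) + (length as + suc (length cs)) ≡⟨ cong₂ _+_ (length-++ bs)
                                                                 (length-++ as) ⟨
    length (bs ++ [ x ]) + length (as ++ x ∷ cs)    ∎
    where
    shuffle : ∀ a b c → a + suc (b + suc c) ≡ (b + 1) + (a + suc c)
    shuffle = solve-∀

  0<length-++-∷ : ∀ (xs : List X) {y ys} → 0 < length (xs ++ y ∷ ys)
  0<length-++-∷ []      = z<s
  0<length-++-∷ (_ ∷ _) = z<s

  module _ (_≟_ : DecidableEquality X) where
    open import Data.List.Membership.DecPropositional _≟_ using (_∈?_)

    unique⊎hasRepeat : ∀ ys → Unique ys ⊎ HasRepeat ys
    unique⊎hasRepeat [] = inj₁ []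
    unique⊎hasRepeat (y ∷ ys) with y ∈? ys | unique⊎hasRepeat ys
    ... | yes y∈ys | _ with ∈-∃++ y∈ys
    ...   | bs , cs , refl = inj₂ ([] , y , bs , cs , refl)
    unique⊎hasRepeat (y ∷ ys) | no y∉ys | inj₁ u = inj₁ (¬Any⇒All¬ ys y∉ys ∷ u)
    unique⊎hasRepeat (y ∷ ys) | no _    | inj₂ (as , x , bs , cs , refl) =
      inj₂ (y ∷ as , x , bs , cs , refl)

-- The list records the vertices after the start, so it ends with the endpoint and its
-- length is the number of edges.
data Walk {n} (A : Matrix n) : Fin n → List (Fin n) → Fin n → Set where
  []  : ∀ {a} → Walk A a [] a
  _∷_ : ∀ {a x xs b} → Edge A a x → Walk A x xs b → Walk A a (x ∷ xs) b

module _ {n} {A : Matrix n} where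

  infixr 5 _++ʷ_

  _++ʷ_ : ∀ {a b c xs ys} → Walk A a xs b → Walk A b ys c → Walk A a (xs ++ ys) c
  []      ++ʷ w = w
  (e ∷ v) ++ʷ w = e ∷ (v ++ʷ w)

  splitʷ : ∀ {a c} xs {ys} → Walk A a (xs ++ ys) c →
           ∃ λ b → Walk A a xs b × Walk A b ys c
  splitʷ []       w       = _ , [] , w
  splitʷ (x ∷ xs) (e ∷ w) = let b , w₁ , w₂ = splitʷ xs w in b , e ∷ w₁ , w₂

  fromStar : ∀ {a b} → Star (Edge A) a b → ∃ λ xs → Walk A a xs b
  fromStar ε       = [] , []
  fromStar (e ◅ s) = let xs , w = fromStar s in _ ∷ xs , e ∷ w

  toPathFrom : ∀ {a b c xs} → Walk A a xs b → Edge A b c → PathFrom A a xs c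
  toPathFrom []       e = e
  toPathFrom (e′ ∷ w) e = e′ , toPathFrom w e

  unique-closedWalk⇒simpleCycle : ∀ {v x xs} → Unique (x ∷ xs) → Walk A v (x ∷ xs) v →
                                  SimpleCycleLength A (length (x ∷ xs))
  unique-closedWalk⇒simpleCycle {x = x} {xs} u (e ∷ w) =
    x , xs , u , toPathFrom w e , refl

  splitAtRepeat : ∀ {v} as {x} bs {cs} → Walk A v (as ++ x ∷ bs ++ x ∷ cs) v →
                  Walk A x (bs ++ [ x ]) x × Walk A v (as ++ x ∷ cs) v
  splitAtRepeat as bs w with splitʷ as w
  ... | _ , w₁ , e₁ ∷ w₂ with splitʷ bs w₂
  ...   | _ , w₃ , e₂ ∷ w₄ = w₃ ++ʷ (e₂ ∷ []) , w₁ ++ʷ (e₁ ∷ w₄)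

  module _ {d} (d∣cycles : ∀ L → SimpleCycleLength A L → d ∣ L) where

    unique-closedWalk-divisible : ∀ {v ys} → Unique ys → Walk A v ys v → d ∣ length ys
    unique-closedWalk-divisible {ys = []}    _ _ = d ∣0
    unique-closedWalk-divisible {ys = _ ∷ _} u w =
      d∣cycles _ (unique-closedWalk⇒simpleCycle u w)

    closedWalk-divisible : ∀ {v ys} → Walk A v ys v → d ∣ length ys
    closedWalk-divisible w = <-rec P step _ w refl
      where
      P : ℕ → Set
      P m = ∀ {v ys} → Walk A v ys v → length ys ≡ m → d ∣ length ys

      step : ∀ m → (∀ {l} → l < m → P l) → P m
      step _ ih {ys = ys} w refl with unique⊎hasRepeat _≟ᶠ_ ys
      ... | inj₁ u = unique-closedWalk-divisible u w
      ... | inj₂ (as , x , bs , cs , refl) =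
        subst (d ∣_) (sym total)
              (∣m∣n⇒∣m+n (ih shorter₁ w₁ refl) (ih shorter₂ w₂ refl))
        where
        w₁ = proj₁ (splitAtRepeat as bs w)
        w₂ = proj₂ (splitAtRepeat as bs w)
        total : length (as ++ x ∷ bs ++ x ∷ cs) ≡
                length (bs ++ [ x ]) + length (as ++ x ∷ cs)
        total = length-repeat as x bs cs
        shorter₁ : length (bs ++ [ x ]) < length (as ++ x ∷ bs ++ x ∷ cs)
        shorter₁ = subst (_ <_) (sym total) (m<m+n _ (0<length-++-∷ as))
        shorter₂ : length (as ++ x ∷ cs) < length (as ++ x ∷ bs ++ x ∷ cs)
        shorter₂ = subst (_ <_) (sym total) (m<n+m _ (0<length-++-∷ bs))

  stronglyConnected⇒outEdge : HasEdge A → StronglyConnected A →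
                              ∀ i → ∃ λ j → Edge A i j
  stronglyConnected⇒outEdge (i , edge) sc v with sc v i
  ... | ε     = edge
  ... | e ◅ _ = _ , e

  walkOfLengthFrom : (∀ i → ∃ λ j → Edge A i j) →
                     ∀ a m → ∃[ xs ] ∃[ b ] length xs ≡ m × Walk A a xs b
  walkOfLengthFrom out a zero    = [] , a , refl , []
  walkOfLengthFrom out a (suc m) =
    let x , e = out a ; xs , b , ℓ , w = walkOfLengthFrom out x m
    in x ∷ xs , b , cong suc ℓ , e ∷ w

  walkOfLengthInto : NonemptyInputs A →
                     ∀ b m → ∃[ a ] ∃[ xs ] length xs ≡ m × Walk A a xs b
  walkOfLengthInto ne b zero    = b , [] , refl , []
  walkOfLengthInto ne b (suc m) =
    let i , e = ne b ; a , xs , ℓ , w = walkOfLengthInto ne i m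
    in a , xs ++ [ b ] , trans (length-++ xs) (trans (+-comm _ 1) (cong suc ℓ)) ,
       w ++ʷ (e ∷ [])

module _ {n} {A : Matrix n} where

  network-lookup : ∀ u j →
    lookup (network A u) j ≡ all (λ i → not (A i j) ∨ lookup u i) (allFin n)
  network-lookup u j = lookup∘tabulate _ j

  network-true⁻ : ∀ {u i j} → lookup (network A u) j ≡ true → Edge A i j →
                  lookup u i ≡ true
  network-true⁻ {u} {i} {j} fu≡true e = not∨-true⁻ (Equivalence.to T-≡ inputᵢ) e
    where
    allInputs = all⁺ _ (allFin n)
                  (Equivalence.from T-≡ (trans (sym (network-lookup u j)) fu≡true))
    inputᵢ = All.lookup allInputs (∈-allFin i)

  network-true⁺ : ∀ {u j} → (∀ i → Edge A i j → lookup u i ≡ true) →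
                  lookup (network A u) j ≡ true
  network-true⁺ {u} {j} h = trans (network-lookup u j) (Equivalence.to T-≡ (all⁻ _ allInputs))
    where
    allInputs = All.tabulate {xs = allFin n} λ {i} _ → Equivalence.from T-≡ (not∨-true⁺ (h i))

  iter-true⇒source-true : ∀ {i xs j} u → Walk A i xs j →
                          lookup (iter (length xs) (network A) u) j ≡ true → lookup u i ≡ true
  iter-true⇒source-true u []                  h = h
  iter-true⇒source-true {j = j} u (_∷_ {xs = xs} e w) h =
    network-true⁻ {u = u} (iter-true⇒source-true (network A u) w
      (subst (λ v → lookup v j ≡ true) (iter-suc (length xs) (network A) u) h)) e

  sources-true⇒iter-true : ∀ m u j →
    (∀ {i xs} → length xs ≡ m → Walk A i xs j → lookup u i ≡ true) →
    lookup (iter m (network A) u) j ≡ true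
  sources-true⇒iter-true zero    u j h = h refl []
  sources-true⇒iter-true (suc m) u j h =
    subst (λ v → lookup v j ≡ true) (sym (iter-suc m (network A) u))
      (sources-true⇒iter-true m (network A u) j λ ℓ w →
        network-true⁺ {u = u} λ _ e → h (cong suc ℓ) (e ∷ w))

module Levels {n} {A : Matrix n} (sc : StronglyConnected A) (root : Fin n)
              (k : ℕ) .{{_ : NonZero k}}
              (closed : ∀ {v ys} → Walk A v ys v → k ∣ length ys) where

  height : Fin n → ℕ
  height j = length (proj₁ (fromStar (sc root j)))

  level : Fin n → Fin k
  level j = height j mod k

  toℕ-level : ∀ j → toℕ (level j) ≡ height j % k
  toℕ-level j = toℕ-fromℕ< (m%n<n (height j) k)

  level-≡ : ∀ {a b} → height a % k ≡ height b % k → level a ≡ level b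
  level-≡ h = toℕ-injective (trans (toℕ-level _) (trans h (sym (toℕ-level _))))

  level-≡⁻ : ∀ {a b} → level a ≡ level b → height a % k ≡ height b % k
  level-≡⁻ h = trans (sym (toℕ-level _)) (trans (cong toℕ h) (toℕ-level _))

  walkFromRoot-height : ∀ {xs a} → Walk A root xs a → length xs % k ≡ height a % k
  walkFromRoot-height {a = a} w =
    %-≡-from-∣+ k (closedVia w) (closedVia (proj₂ (fromStar (sc root a))))
    where
    back = fromStar (sc a root)
    closedVia : ∀ {ys} → Walk A root ys a → k ∣ length ys + length (proj₁ back)
    closedVia {ys} w = subst (k ∣_) (length-++ ys) (closed (w ++ʷ proj₂ back))

  walk-height : ∀ {a xs b} → Walk A a xs b → (height a + length xs) % k ≡ height b % k
  walk-height {a} w = subst (λ l → l % k ≡ _) (length-++ (proj₁ toA))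
                            (walkFromRoot-height (proj₂ toA ++ʷ w))
    where toA = fromStar (sc root a)

  walkOfLength-k-preserves-level : ∀ {a xs b} → Walk A a xs b → length xs ≡ k →
                                   level a ≡ level b
  walkOfLength-k-preserves-level {a} {xs} {b} w ℓ = level-≡ (begin
    height a % k                ≡⟨ [m+n]%n≡m%n (height a) k ⟨
    (height a + k) % k          ≡⟨ cong (λ l → (height a + l) % k) ℓ ⟨
    (height a + length xs) % k  ≡⟨ walk-height w ⟩
    height b % k                ∎)

  sameLevel⇒k∣length : ∀ {a xs b} → level a ≡ level b → Walk A a xs b → k ∣ length xs
  sameLevel⇒k∣length {a} same w =
    ∣-from-%-+ k (height a) (trans (walk-height w) (sym (level-≡⁻ same)))

  walkFromRoot-level : ∀ {xs a} (s : Fin k) → Walk A root xs a → length xs ≡ toℕ s →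
                       level a ≡ s
  walkFromRoot-level {xs} {a} s w ℓ = toℕ-injective (begin
    toℕ (level a)   ≡⟨ toℕ-level a ⟩
    height a % k    ≡⟨ walkFromRoot-height w ⟨
    length xs % k   ≡⟨ cong (_% k) ℓ ⟩
    toℕ s % k       ≡⟨ m<n⇒m%n≡m (toℕ<n s) ⟩
    toℕ s           ∎)

module PeriodicPoints {n} {A : Matrix n} (ne : NonemptyInputs A) (he : HasEdge A)
                      (sc : StronglyConnected A) (k : ℕ) .{{_ : NonZero k}}
                      (k∣cycles : ∀ L → SimpleCycleLength A L → k ∣ L) where

  open Levels sc (proj₁ he) k (closedWalk-divisible k∣cycles)

  f : Vec Bool n → Vec Bool n
  f = network A

  Periodic : Set
  Periodic = Σ (Vec Bool n) (λ u → iter k f u ≡ u)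

  periodic⇒true-spreads-back : ∀ {u a b} → iter k f u ≡ u → level a ≡ level b →
                               lookup u b ≡ true → lookup u a ≡ true
  periodic⇒true-spreads-back {u} {a} {b} periodic same ub≡true
    with xs , w ← fromStar (sc a b)
    with divides e ℓ ← sameLevel⇒k∣length same w =
    iter-true⇒source-true u w (subst (λ v → lookup v b ≡ true) (sym iterᵗu≡u) ub≡true)
    where
    iterᵗu≡u : iter (length xs) f u ≡ u
    iterᵗu≡u = trans (cong (λ m → iter m f u) ℓ) (iter-*-periodic periodic e)

  periodic⇒level-constant : ∀ {u a b} → iter k f u ≡ u → level a ≡ level b →
                            lookup u a ≡ lookup u b
  periodic⇒level-constant periodic same =
    ≡-from-true⇔true (periodic⇒true-spreads-back periodic (sym same))
                     (periodic⇒true-spreads-back periodic same)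

  onLevels : Vec Bool k → Vec Bool n
  onLevels g = tabulate (lookup g ∘ level)

  lookup-onLevels : ∀ g j → lookup (onLevels g) j ≡ lookup g (level j)
  lookup-onLevels g j = lookup∘tabulate (lookup g ∘ level) j

  onLevels-sameLevel : ∀ g {a b} → level a ≡ level b →
                       lookup (onLevels g) a ≡ lookup (onLevels g) b
  onLevels-sameLevel g {a} {b} same =
    trans (lookup-onLevels g a) (trans (cong (lookup g) same) (sym (lookup-onLevels g b)))

  onLevels-periodic : ∀ g → iter k f (onLevels g) ≡ onLevels g
  onLevels-periodic g = lookup-ext λ j → ≡-from-true⇔true (iterTrue⇒true j) (true⇒iterTrue j)
    where
    u = onLevels g

    iterTrue⇒true : ∀ j → lookup (iter k f u) j ≡ true → lookup u j ≡ true
    iterTrue⇒true j h with i , xs , ℓ , w ← walkOfLengthInto ne j k =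
      trans (sym (onLevels-sameLevel g (walkOfLength-k-preserves-level w ℓ)))
            (iter-true⇒source-true u w
              (subst (λ m → lookup (iter m f u) j ≡ true) (sym ℓ) h))

    true⇒iterTrue : ∀ j → lookup u j ≡ true → lookup (iter k f u) j ≡ true
    true⇒iterTrue j uj≡true = sources-true⇒iter-true k u j λ ℓ w →
      trans (onLevels-sameLevel g (walkOfLength-k-preserves-level w ℓ)) uj≡true

  walkFromRoot : ∀ m → ∃[ xs ] ∃[ b ] length xs ≡ m × Walk A (proj₁ he) xs b
  walkFromRoot = walkOfLengthFrom (stronglyConnected⇒outEdge he sc) (proj₁ he)

  representative : Fin k → Fin n
  representative s = proj₁ (proj₂ (walkFromRoot (toℕ s)))

  level-representative : ∀ s → level (representative s) ≡ s
  level-representative s with _ , _ , ℓ , w ← walkFromRoot (toℕ s) = walkFromRoot-level s w ℓ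

  Periodic-≡ : ∀ {u v} (p : iter k f u ≡ u) (q : iter k f v ≡ v) → u ≡ v →
               _≡_ {A = Periodic} (u , p) (v , q)
  Periodic-≡ p q refl = cong (_ ,_) (Decidable⇒UIP.≡-irrelevant (≡-dec _≟ᵇ_) p q)

  Periodic↔Vec : Periodic ↔ Vec Bool k
  Periodic↔Vec = mk↔ₛ′ toLevels fromLevels toLevels∘fromLevels fromLevels∘toLevels
    where
    toLevels : Periodic → Vec Bool k
    toLevels (u , _) = tabulate (lookup u ∘ representative)

    fromLevels : Vec Bool k → Periodic
    fromLevels g = onLevels g , onLevels-periodic g

    toLevels∘fromLevels : ∀ g → toLevels (fromLevels g) ≡ g
    toLevels∘fromLevels g = lookup-ext λ s → begin
      lookup (toLevels (fromLevels g)) s       ≡⟨ lookup∘tabulate _ s ⟩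
      lookup (onLevels g) (representative s)   ≡⟨ lookup-onLevels g (representative s) ⟩
      lookup g (level (representative s))      ≡⟨ cong (lookup g) (level-representative s) ⟩
      lookup g s                               ∎

    fromLevels∘toLevels : ∀ x → fromLevels (toLevels x) ≡ x
    fromLevels∘toLevels x@(u , periodic) = Periodic-≡ _ periodic (lookup-ext λ j → begin
      lookup (onLevels (toLevels x)) j     ≡⟨ lookup-onLevels (toLevels x) j ⟩
      lookup (toLevels x) (level j)        ≡⟨ lookup∘tabulate _ (level j) ⟩
      lookup u (representative (level j))  ≡⟨ periodic⇒level-constant periodic
                                                (level-representative (level j)) ⟩
      lookup u j                           ∎)

mainTheorem6 : (n : ℕ) (A : Matrix n) → NonemptyInputs A → HasEdge A → StronglyConnected A
    → (c : ℕ) → IsLoopNumber A c → (k : ℕ) → k > 0 → k ∣ c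
    → Σ (Vec Bool n) (λ u → iter k (network A) u ≡ u) ↔ Fin (2 ^ k)
mainTheorem6 n A ne he sc c (c∣cycles , _) k@(suc _) _ k∣c =
  ↔-trans (PeriodicPoints.Periodic↔Vec ne he sc k k∣cycles) (Vec-Bool↔Fin-2^ k)
  where
  k∣cycles : ∀ L → SimpleCycleLength A L → k ∣ L
  k∣cycles L cycle = ∣-trans k∣c (c∣cycles L cycle)
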